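{- Let $k,d,C\in\mathbb{N}$, let $T$ be a $(k,d)$-broom rooted at $v$, and suppose the leaves of $T$ are colored with $C$ colors. Then there exists a $(k,\lceil d/C\rceil)$-broom $T'\subseteq T$ rooted at $v$ such that the leaves of $T'$ form a monochromatic subset of the leaves of $T$.
   Context: An out-arborescence is an oriented tree with a designated root such that all arcs are oriented away from the root; it is balanced if all root-to-leaf paths have the same length, and its height is the maximum length of a root-to-leaf path. For $k,d\in\mathbb{N}$, a $(k,d)$-broom rooted at $r$ is an out-arborescence $T$ with root $r$ for which there is an integer $1\le \ell\le k+1$ such that either (i) $\ell\le k$ and $T$ is a balanced out-arborescence of height $\ell$ in which every non-leaf vertex has out-degree exactly $d$; or (ii) $\ell=k+1$ and $T$ is obtained from a balanced out-arborescence of height $k+1$ in which every non-leaf vertex has out-degree exactly $d$ by subdividing each out-arc of $r$ an arbitrary number of times. -}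

module Defs where

open import Data.Nat using (ℕ; zero; suc; _+_; _∸_; _≤_; NonZero)
open import Data.Nat.DivMod using (_/_)
open import Data.Fin using (Fin)
open import Data.List using (List; []; _∷_; length; lookup)
open import Data.List.Relation.Unary.All using (All)
open import Data.Product using (Σ; _×_; ∃)
open import Data.Sum using (_⊎_)
open import Relation.Binary.PropositionalEquality using (_≡_)
open import Function.Definitions using (Injective)

-- Finite rooted out-arborescences: a vertex together with the list of
-- out-subtrees hanging from its out-neighbours (order of children immaterial).
data Tree : Set where
  node : List Tree → Tree

-- Vertices of a tree, given by their path from the root.
data Pos : Tree → Set where
  here  : ∀ {t} → Pos t
  child : ∀ {ts} (i : Fin (length ts)) → Pos (lookup ts i) → Pos (node ts)

at : (t : Tree) → Pos t → Tree
at t here = t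
at (node ts) (child i p) = at (lookup ts i) p

IsLeaf : (t : Tree) → Pos t → Set
IsLeaf t p = at t p ≡ node []

-- T' ⊑ T : T' is a sub-arborescence of T with the same root
-- (children of each vertex are mapped injectively to children of its image).
data _⊑_ : Tree → Tree → Set where
  emb : ∀ {ts' ts} (f : Fin (length ts') → Fin (length ts)) →
        Injective _≡_ _≡_ f →
        ((i : Fin (length ts')) → lookup ts' i ⊑ lookup ts (f i)) →
        node ts' ⊑ node ts

embPos : ∀ {t' t} → t' ⊑ t → Pos t' → Pos t
embPos e here = here
embPos (emb f _ g) (child i p) = child (f i) (embPos (g i) p)

Full : ℕ → ℕ → Tree → Set
Full d zero t = t ≡ node []
Full d (suc ℓ) (node ts) = length ts ≡ d × All (Full d ℓ) ts

-- t is obtained from a tree satisfying P by prepending a directed path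
-- of arbitrary length (0 or more subdivision vertices) above its root.
data Subdiv (P : Tree → Set) : Tree → Set where
  base : ∀ {t} → P t → Subdiv P t
  step : ∀ {t} → Subdiv P t → Subdiv P (node (t ∷ []))

Broom : ℕ → ℕ → Tree → Set
Broom k d t =
  (Σ ℕ λ ℓ → 1 ≤ ℓ × ℓ ≤ k × Full d ℓ t)
  ⊎ (Σ (List Tree) λ ts → t ≡ node ts × length ts ≡ d × All (Subdiv (Full d k)) ts)

⌈_/_⌉ : (d C : ℕ) → .{{NonZero C}} → ℕ
⌈ d / C ⌉ = (d + C ∸ 1) / C

-- Colour every vertex by the colour of a monochromatic subtree found below
-- it, working from the leaves up. At a vertex with d children, the
-- pigeonhole principle yields ⌈ d / C ⌉ children whose subtrees share a
-- colour; keeping exactly those children and their subtrees gives a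
-- monochromatic tree of the same shape with out-degree ⌈ d / C ⌉. The
-- subdivided arms of a broom are single paths, which are kept whole.
module Submission where

open import Defs
open import Data.Nat using (ℕ; zero; suc; _+_; _*_; _∸_; _≤_; _<_; s≤s⁻¹; NonZero)
open import Data.Nat.Properties
  using (+-suc; +-comm; *-comm; n<1+n; m≤n+m; ≤-refl; ≤-trans; ≤-total; >⇒≢;
         +-mono-≤; +-monoˡ-≤; +-monoʳ-≤; +-monoʳ-<; *-monoʳ-≤; module ≤-Reasoning;
         +-0-commutativeMonoid)
open import Data.Nat.DivMod using (_/_; /-congˡ; m<n⇒m/n≡0; m≥n⇒m/n>0; m<n*o⇒m/o<n)
open import Data.Fin using (Fin; zero; suc; toℕ; cast; inject≤; _≟_)
open import Data.Fin.Properties using (suc-injective; toℕ-injective; toℕ-cast; toℕ-inject≤)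
open import Data.List using (List; []; _∷_; length; lookup; tabulate)
open import Data.List.Properties using (length-tabulate)
open import Data.List.Relation.Unary.All as All using (All; [])
open import Data.List.Relation.Unary.All.Properties using (tabulate⁺)
open import Data.List.Membership.Propositional.Properties using (∈-lookup)
open import Data.Product using (Σ; ∃-syntax; _×_; _,_; proj₁; proj₂)
open import Data.Sum using (inj₁; inj₂)
open import Data.Empty using (⊥-elim)
open import Relation.Nullary using (yes; no)
open import Relation.Binary.PropositionalEquality
  using (_≡_; _≢_; refl; sym; trans; cong; cong₂; subst; module ≡-Reasoning)
open import Function using (_∘_)
open import Function.Definitions using (Injective)
open import Algebra.Properties.CommutativeMonoid.Sum +-0-commutativeMonoid
  using (sum; sum-syntax; ∑-distrib-+; sum-replicate-zero)

private
  variable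
    m n C : ℕ

m≤n*o⇒⌈m/n⌉≤o : ∀ m {n o} .{{_ : NonZero n}} → m ≤ n * o → ⌈ m / n ⌉ ≤ o
m≤n*o⇒⌈m/n⌉≤o m {n@(suc n-1)} {o} m≤n*o =
  s≤s⁻¹ (subst (_< suc o) (/-congˡ (cong (_∸ 1) (sym (+-suc m n-1)))) (m<n*o⇒m/o<n m+n-1<[1+o]*n))
  where
  open ≤-Reasoning
  m+n-1<[1+o]*n : m + n-1 < suc o * n
  m+n-1<[1+o]*n = begin-strict
    m + n-1    <⟨ +-monoʳ-< m (n<1+n n-1) ⟩
    m + n      ≤⟨ +-monoˡ-≤ n m≤n*o ⟩
    n * o + n  ≡⟨ +-comm (n * o) n ⟩
    n + n * o  ≡⟨ cong (n +_) (*-comm n o) ⟩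
    suc o * n  ∎

⌈0/n⌉≡0 : .{{_ : NonZero n}} → ⌈ 0 / n ⌉ ≡ 0
⌈0/n⌉≡0 {suc n-1} = m<n⇒m/n≡0 (n<1+n n-1)

⌈1+m/n⌉>0 : ∀ m .{{_ : NonZero n}} → 0 < ⌈ suc m / n ⌉
⌈1+m/n⌉>0 {suc n-1} m = m≥n⇒m/n>0 (m≤n+m (suc n-1) m)

δ : Fin n → Fin n → ℕ
δ zero    zero    = 1
δ zero    (suc _) = 0
δ (suc _) zero    = 0
δ (suc a) (suc b) = δ a b

δ-≡ : {a b : Fin n} → a ≡ b → δ a b ≡ 1
δ-≡ {a = zero}  refl = refl
δ-≡ {a = suc a} refl = δ-≡ {a = a} refl

δ-≢ : {a b : Fin n} → a ≢ b → δ a b ≡ 0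
δ-≢ {a = zero}  {zero}  a≢b = ⊥-elim (a≢b refl)
δ-≢ {a = zero}  {suc b} a≢b = refl
δ-≢ {a = suc a} {zero}  a≢b = refl
δ-≢ {a = suc a} {suc b} a≢b = δ-≢ (a≢b ∘ cong suc)

∑-δ : (a : Fin n) → ∑[ b < n ] δ a b ≡ 1
∑-δ {suc n} zero    = cong suc (sum-replicate-zero n)
∑-δ {suc n} (suc a) = ∑-δ a

count : (Fin m → Fin C) → Fin C → ℕ
count {m} χ c = ∑[ i < m ] δ (χ i) c

∑-count : (χ : Fin m → Fin C) → ∑[ c < C ] count χ c ≡ m
∑-count {zero}  {C} χ = sum-replicate-zero C
∑-count {suc m} {C} χ = begin
  ∑[ c < C ] (δ (χ zero) c + count (χ ∘ suc) c)       ≡⟨ ∑-distrib-+ (δ (χ zero)) (count (χ ∘ suc)) ⟩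
  ∑[ c < C ] δ (χ zero) c + ∑[ c < C ] count (χ ∘ suc) c ≡⟨ cong₂ _+_ (∑-δ (χ zero)) (∑-count (χ ∘ suc)) ⟩
  suc m                                                ∎
  where open ≡-Reasoning

fibre : (χ : Fin m → Fin C) (c : Fin C) →
        Σ (Fin (count χ c) → Fin m) λ f → Injective _≡_ _≡_ f × (∀ j → χ (f j) ≡ c)
fibre {zero} χ c = (λ ()) , (λ {}) , (λ ())
fibre {suc m} χ c with χ zero ≟ c | fibre (χ ∘ suc) c
... | yes χ₀≡c | f , f-inj , f-col rewrite δ-≡ χ₀≡c = f′ , f′-inj , f′-col
  where
  f′ : Fin (suc (count (χ ∘ suc) c)) → Fin (suc m)
  f′ zero    = zero
  f′ (suc j) = suc (f j)
  f′-inj : Injective _≡_ _≡_ f′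
  f′-inj {zero}  {zero}  _  = refl
  f′-inj {suc i} {suc j} eq = cong suc (f-inj (suc-injective eq))
  f′-col : ∀ j → χ (f′ j) ≡ c
  f′-col zero    = χ₀≡c
  f′-col (suc j) = f-col j
... | no  χ₀≢c | f , f-inj , f-col rewrite δ-≢ χ₀≢c = suc ∘ f , f-inj ∘ suc-injective , f-col

∃-entry≥average : (g : Fin (suc n) → ℕ) → ∃[ c ] ∑[ i < suc n ] g i ≤ suc n * g c
∃-entry≥average {zero}  g = zero , ≤-refl
∃-entry≥average {suc n} g with ∃-entry≥average (g ∘ suc)
... | c , ∑≤ with ≤-total (g zero) (g (suc c))
...   | inj₁ g₀≤ = suc c , +-mono-≤ g₀≤ ∑≤
...   | inj₂ ≤g₀ = zero , +-monoʳ-≤ (g zero) (≤-trans ∑≤ (*-monoʳ-≤ (suc n) ≤g₀))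

inject≤-injective : .(m≤n : m ≤ n) → Injective _≡_ _≡_ (λ (i : Fin m) → inject≤ i m≤n)
inject≤-injective m≤n {i} {j} eq =
  toℕ-injective (trans (sym (toℕ-inject≤ i m≤n)) (trans (cong toℕ eq) (toℕ-inject≤ j m≤n)))

cast-injective : .(eq : m ≡ n) → Injective _≡_ _≡_ (cast eq)
cast-injective eq {i} {j} ci≡cj =
  toℕ-injective (trans (sym (toℕ-cast eq i)) (trans (cong toℕ ci≡cj) (toℕ-cast eq j)))

pigeonhole : .{{_ : NonZero C}} (χ : Fin m → Fin C) →
  ∃[ c ] Σ (Fin ⌈ m / C ⌉ → Fin m) λ f → Injective _≡_ _≡_ f × (∀ j → χ (f j) ≡ c)
pigeonhole {C@(suc _)} {m} χ with ∃-entry≥average (count χ)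
... | c , ∑≤ with fibre χ c
...   | f , f-inj , f-col = c , f ∘ ι , inject≤-injective ⌈m/C⌉≤count ∘ f-inj , f-col ∘ ι
  where
  ⌈m/C⌉≤count : ⌈ m / C ⌉ ≤ count χ c
  ⌈m/C⌉≤count = m≤n*o⇒⌈m/n⌉≤o m (subst (_≤ C * count χ c) (∑-count χ) ∑≤)
  ι : Fin ⌈ m / C ⌉ → Fin (count χ c)
  ι j = inject≤ j ⌈m/C⌉≤count

lookup-tabulate⁺ : ∀ {a ℓ} {A : Set a} {g : Fin n → A} (R : Fin n → A → Set ℓ) →
  (∀ j → R j (g j)) → ∀ i → R (cast (length-tabulate g) i) (lookup (tabulate g) i)
lookup-tabulate⁺ {suc n} R r zero    = r zero
lookup-tabulate⁺ {suc n} R r (suc i) = lookup-tabulate⁺ (R ∘ suc) (r ∘ suc) i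

Colouring : ℕ → Tree → Set
Colouring C T = (p : Pos T) → IsLeaf T p → Fin C

childColouring : ∀ {ts} → Colouring C (node ts) → (i : Fin (length ts)) → Colouring C (lookup ts i)
childColouring col i p = col (child i p)

Monochromatic : ∀ {T′ T} → T′ ⊑ T → Colouring C T → Fin C → Set
Monochromatic {T′ = T′} {T} e col c =
  (p : Pos T′) → IsLeaf T′ p → Σ (IsLeaf T (embPos e p)) λ l → col (embPos e p) l ≡ c

record MonochromaticSubtree (P : Tree → Set) (T : Tree) (col : Colouring C T) : Set where
  constructor monochromaticSubtree
  field
    subtree       : Tree
    embedding     : subtree ⊑ T
    satisfies     : P subtree
    colour        : Fin C
    monochromatic : Monochromatic embedding col colour

open MonochromaticSubtree

MonochromaticSubtree-map : ∀ {P Q : Tree → Set} {T} {col : Colouring C T} →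
  (∀ {t} → P t → Q t) → MonochromaticSubtree P T col → MonochromaticSubtree Q T col
MonochromaticSubtree-map P⇒Q (monochromaticSubtree t e p c mono) = monochromaticSubtree t e (P⇒Q p) c mono

leaf-monochromatic : ∀ {P : Tree → Set} → P (node []) → (col : Colouring C (node [])) →
  MonochromaticSubtree P (node []) col
leaf-monochromatic p col = monochromaticSubtree (node []) (emb (λ ()) (λ {}) (λ ())) p (col here refl) mono
  where
  mono : Monochromatic _ col (col here refl)
  mono here refl = refl , refl

node-injective : ∀ {ts ts′} → node ts ≡ node ts′ → ts ≡ ts′
node-injective refl = refl

Fan : ℕ → (Tree → Set) → Tree → Set
Fan n P (node ts) = length ts ≡ n × All P ts

module _ .{{_ : NonZero C}} where

  monochromatic-fan : ∀ {P ts} {col : Colouring C (node ts)} →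
    (∀ i → MonochromaticSubtree P (lookup ts i) (childColouring col i)) →
    MonochromaticSubtree (Fan ⌈ length ts / C ⌉ P) (node ts) col
  monochromatic-fan {ts = []} {col} _ = leaf-monochromatic (sym ⌈0/n⌉≡0 , []) col
  monochromatic-fan {P} {ts@(_ ∷ ts₀)} {col} sub with pigeonhole (colour ∘ sub)
  ... | c , f , f-inj , f-col =
    monochromaticSubtree (node children) e (length-tabulate g , tabulate⁺ (satisfies ∘ sub ∘ f)) c mono
    where
    g : Fin ⌈ length ts / C ⌉ → Tree
    g = subtree ∘ sub ∘ f
    children : List Tree
    children = tabulate g
    ι : Fin (length children) → Fin ⌈ length ts / C ⌉
    ι = cast (length-tabulate g)
    EmbeddedBelow : Fin ⌈ length ts / C ⌉ → Tree → Set
    EmbeddedBelow j t = Σ (t ⊑ lookup ts (f j)) λ e → Monochromatic e (childColouring col (f j)) c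
    embedded : ∀ i → EmbeddedBelow (ι i) (lookup children i)
    embedded = lookup-tabulate⁺ EmbeddedBelow λ j →
      embedding (sub (f j)) ,
      subst (Monochromatic _ (childColouring col (f j))) (f-col j) (monochromatic (sub (f j)))
    e : node children ⊑ node ts
    e = emb (f ∘ ι) (cast-injective _ ∘ f-inj) (proj₁ ∘ embedded)
    mono : Monochromatic e col c
    mono here l = ⊥-elim (>⇒≢ (⌈1+m/n⌉>0 (length ts₀)) (begin
      ⌈ length ts / C ⌉  ≡⟨ sym (length-tabulate g) ⟩
      length children   ≡⟨ cong length (node-injective l) ⟩
      0                 ∎))
      where open ≡-Reasoning
    mono (child i p) = proj₂ (embedded i) p

  monochromatic-full : ∀ {d} ℓ {T} → Full d ℓ T → (col : Colouring C T) →
    MonochromaticSubtree (Full ⌈ d / C ⌉ ℓ) T col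
  monochromatic-full zero    refl col = leaf-monochromatic refl col
  monochromatic-full (suc ℓ) {node ts} (refl , full) col =
    MonochromaticSubtree-map (λ { {node _} fan → fan })
      (monochromatic-fan λ i → monochromatic-full ℓ (All.lookup full (∈-lookup i)) (childColouring col i))

monochromatic-subdiv : ∀ {P Q : Tree → Set} →
  (∀ {t} → P t → (col : Colouring C t) → MonochromaticSubtree Q t col) →
  ∀ {T} → Subdiv P T → (col : Colouring C T) → MonochromaticSubtree (Subdiv Q) T col
monochromatic-subdiv P⇒Q (base p) col = MonochromaticSubtree-map base (P⇒Q p col)
monochromatic-subdiv P⇒Q {node (arm ∷ [])} (step s) col with monochromatic-subdiv P⇒Q s (childColouring col zero)
... | monochromaticSubtree t e q c mono = monochromaticSubtree (node (t ∷ [])) e′ (step q) c mono′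
  where
  e′ : node (t ∷ []) ⊑ node (arm ∷ [])
  e′ = emb (λ _ → zero) (λ { {zero} {zero} _ → refl }) (λ { zero → e })
  mono′ : Monochromatic e′ col c
  mono′ (child zero p) = mono p

monochromatic-broom : ∀ {k d T} .{{_ : NonZero C}} → Broom k d T → (col : Colouring C T) →
  MonochromaticSubtree (Broom k ⌈ d / C ⌉) T col
monochromatic-broom (inj₁ (ℓ , 1≤ℓ , ℓ≤k , full)) col =
  MonochromaticSubtree-map (λ full′ → inj₁ (ℓ , 1≤ℓ , ℓ≤k , full′)) (monochromatic-full ℓ full col)
monochromatic-broom {k = k} (inj₂ (ts , refl , refl , arms)) col =
  MonochromaticSubtree-map (λ { {node ts′} (len , arms′) → inj₂ (ts′ , refl , len , arms′) })
    (monochromatic-fan λ i →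
      monochromatic-subdiv (monochromatic-full k) (All.lookup arms (∈-lookup i)) (childColouring col i))

corollary2p9 : (k d C : ℕ) → .{{_ : NonZero C}} → (T : Tree) → Broom k d T →
    (col : (p : Pos T) → IsLeaf T p → Fin C) →
    Σ Tree λ T' → Σ (T' ⊑ T) λ e → Broom k ⌈ d / C ⌉ T' ×
      Σ (Fin C) λ c → (p : Pos T') → IsLeaf T' p →
        Σ (IsLeaf T (embPos e p)) λ l → col (embPos e p) l ≡ c
corollary2p9 k d C T broom col with monochromatic-broom broom col
... | monochromaticSubtree T′ e broom′ c mono = T′ , e , broom′ , c , mono
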